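{- Let $a=[a_0;a_1,\dots,a_{k-1}]$ be the continued fraction expansion of a positive rational number, let $(b_i)_{0\leq i<k}$ be an admissible sequence for $a$, and let $n=\sum_{i=0}^{k-1}(-1)^ib_ir_i$. Then $n<r_{k-1}$ if $k$ is even, and $n<r_k$ if $k$ is odd.
   Context: $a_0\ge0$, $a_i\ge1$ for $1\le i<k$. $r_{ -1}=r_0=1$ and $r_i=a_{i-1}r_{i-1}+r_{i-2}$ for $1\le i\le k$. A sequence $(b_i)_{0\le i<k}$ of integers is admissible for $a$ if $0\le b_i\le a_i$; if $i>0$ is odd and $b_i=a_i$ then $b_{i-1}=a_{i-1}$; if $i>0$ is even and $b_i=0$ then $b_{i-1}=0$. -}

module Defs where

open import Data.Nat using (ℕ; zero; suc; _+_; _*_; _≤_; _<_)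
open import Data.Integer as ℤ using (ℤ; +_)
open import Data.Product using (_×_)
open import Data.Bool using (Bool; true; false; not; if_then_else_)
open import Relation.Binary.PropositionalEquality using (_≡_)

isEven : ℕ → Bool
isEven zero = true
isEven (suc n) = not (isEven n)

-- Sequences are given as functions ℕ → ℕ; only indices i < k matter.

-- rr a j = r_{j-1}:  rr a 0 = r_{-1} = 1, rr a 1 = r_0 = 1, and
-- r_i = a_{i-1} r_{i-1} + r_{i-2}.
rr : (ℕ → ℕ) → ℕ → ℕ
rr a zero = 1
rr a (suc zero) = 1
rr a (suc (suc j)) = a j * rr a (suc j) + rr a j

r : (ℕ → ℕ) → ℕ → ℕ
r a i = rr a (suc i)

-- a = [a_0; a_1, ..., a_{k-1}] is the continued fraction expansion of a
-- positive rational: k ≥ 1, a_0 ≥ 0, a_i ≥ 1 for 1 ≤ i < k, and the value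
-- is positive (a_0 ≥ 1 when k = 1).
IsCF : ℕ → (ℕ → ℕ) → Set
IsCF k a = (1 ≤ k) × ((i : ℕ) → 1 ≤ i → i < k → 1 ≤ a i) × (k ≡ 1 → 1 ≤ a 0)

-- Admissibility of (b_i)_{0 ≤ i < k} for a:
--  * 0 ≤ b_i ≤ a_i for i < k;
--  * i = 2j+1 odd, i < k, b_i = a_i  ⇒  b_{i-1} = a_{i-1};
--  * i = 2j+2 even (> 0), i < k, b_i = 0  ⇒  b_{i-1} = 0.
Admissible : ℕ → (ℕ → ℕ) → (ℕ → ℕ) → Set
Admissible k a b =
  ((i : ℕ) → i < k → b i ≤ a i) ×
  ((j : ℕ) → suc (j + j) < k → b (suc (j + j)) ≡ a (suc (j + j)) → b (j + j) ≡ a (j + j)) ×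
  ((j : ℕ) → suc (suc (j + j)) < k → b (suc (suc (j + j))) ≡ 0 → b (suc (j + j)) ≡ 0)

signed : ℕ → ℕ → ℤ
signed i x = if isEven i then + x else ℤ.- (+ x)

altSum : (ℕ → ℕ) → (ℕ → ℕ) → ℕ → ℤ
altSum a b zero = + 0
altSum a b (suc m) = altSum a b m ℤ.+ signed m (b m * r a m)

-- Induct on the number m of terms,
-- with bound r_{m-1} for m even and r_m for m odd.  An even-indexed term adds
-- b_m r_m ≤ a_m r_m, raising the bound r_{m-1} to a_m r_m + r_{m-1} = r_{m+1};
-- an odd-indexed term is nonpositive, so the bound r_m is kept.
module Submission where

open import Defs
open import Data.Nat as ℕ using (ℕ; zero; suc)
import Data.Nat.Properties as ℕ
open import Data.Integer using (+_; _+_; _-_; _<_; +<+; +≤+)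
open import Data.Integer.Properties
  using (+-mono-<-≤; pos-+; i-j≤i; ≤-<-trans; module ≤-Reasoning)
open import Data.Bool using (true; false; if_then_else_)
open import Data.Product using (_,_)
open import Relation.Binary.PropositionalEquality using (sym; cong)

+-mono-<-≤-pos : ∀ {x p m n} → x < + p → m ℕ.≤ n → x + + m < + (n ℕ.+ p)
+-mono-<-≤-pos {x} {p} {m} {n} x<p m≤n = begin-strict
  x + + m       <⟨ +-mono-<-≤ x<p (+≤+ m≤n) ⟩
  + p + + n     ≡⟨ sym (pos-+ p n) ⟩
  + (p ℕ.+ n)   ≡⟨ cong +_ (ℕ.+-comm p n) ⟩
  + (n ℕ.+ p)   ∎
  where open ≤-Reasoning

i<j⇒i-+n<j : ∀ {i j} n → i < j → i - + n < j
i<j⇒i-+n<j {i} n = ≤-<-trans (i-j≤i i (+ n))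

altSumBound : (ℕ → ℕ) → ℕ → ℕ
altSumBound a m = if isEven m then rr a m else r a m

altSum<altSumBound : (a b : ℕ → ℕ) (m : ℕ) → (∀ i → i ℕ.< m → b i ℕ.≤ a i) →
  altSum a b m < + altSumBound a m
altSum<altSumBound a b zero b≤a = +<+ (ℕ.s≤s ℕ.z≤n)
altSum<altSumBound a b (suc m) b≤a
  with isEven m | altSum<altSumBound a b m (λ i i<m → b≤a i (ℕ.m<n⇒m<1+n i<m))
... | true  | ih = +-mono-<-≤-pos ih (ℕ.*-monoˡ-≤ (r a m) (b≤a m ℕ.≤-refl))
... | false | ih = i<j⇒i-+n<j (b m ℕ.* r a m) ih

lemma4p2 : (k : ℕ) (a b : ℕ → ℕ) → IsCF k a → Admissible k a b →
    altSum a b k < (+ (if isEven k then rr a k else r a k))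
lemma4p2 k a b _ (b≤a , _ , _) = altSum<altSumBound a b k b≤a
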